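{- Let $p$ be a prime. If $p\ne2$, there is an identity of polynomials in $(\mathbb{Z}/p\mathbb{Z})[x]$ $$h(x,1-x)=\sum_{r=1}^{p-1}\frac{x^r}{r},$$ and if $p=2$, there is an identity of polynomials $h(x,1-x)=x+x^2$.
   Context: The two-variable polynomial $h(x,y)\in(\mathbb{Z}/p\mathbb{Z})[x,y]$ is $h(x,y)=-\sum_{r_1,r_2}\frac{x^{r_1}y^{r_2}}{r_1!r_2!}$, the sum over $0\le r_1,r_2<p$ with $r_1+r_2=p$. -}

module Defs where

open import Data.Nat as ℕ using (ℕ; zero; suc; _∸_)
open import Data.Nat using (_!)
open import Data.Integer as ℤ using (ℤ; +_; _+_; _*_; -_; _-_)
import Data.Integer.Divisibility as ℤDiv
import Data.Nat.Divisibility as ℕDiv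
open import Relation.Nullary using (¬_)

ModEq : ℕ → ℤ → ℤ → Set
ModEq p a b = (+ p) ℤDiv.∣ (a - b)

IsInverseMod : ℕ → (ℕ → ℤ) → Set
IsInverseMod p inv = ∀ (a : ℕ) → ¬ (p ℕDiv.∣ a) → ModEq p (inv a * + a) (+ 1)

sumℤ : ℕ → (ℕ → ℤ) → ℤ
sumℤ zero    f = + 0
sumℤ (suc n) f = sumℤ n f + f n

-- Polynomials in one variable x, given by their coefficient sequences
-- (coefficient of x^n); integer coefficients, read modulo p.
Poly : Set
Poly = ℕ → ℤ

const : ℤ → Poly
const c zero    = c
const c (suc n) = + 0

X : Poly
X zero          = + 0
X (suc zero)    = + 1
X (suc (suc n)) = + 0

infixl 6 _⊕_
infixl 7 _⊛_

_⊕_ : Poly → Poly → Poly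
(f ⊕ g) n = f n + g n

⊖_ : Poly → Poly
(⊖ f) n = - f n

_⊛_ : Poly → Poly → Poly
(f ⊛ g) n = sumℤ (suc n) (λ i → f i * g (n ∸ i))

_^ₚ_ : Poly → ℕ → Poly
f ^ₚ zero    = const (+ 1)
f ^ₚ suc k   = (f ^ₚ k) ⊛ f

psum : ℕ → (ℕ → Poly) → Poly
psum zero    F = const (+ 0)
psum (suc n) F = psum n F ⊕ F n

_≈[_]_ : Poly → ℕ → Poly → Set
f ≈[ p ] g = ∀ (n : ℕ) → ModEq p (f n) (g n)

-- h(x,y) = - Σ_{0 ≤ r₁,r₂ < p, r₁ + r₂ = p} x^r₁ y^r₂ / (r₁! r₂!),
-- evaluated at polynomials x, y; the pairs (r₁,r₂) are exactly
-- r₁ = 1, ..., p-1 with r₂ = p - r₁.  Division by r₁! r₂! is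
-- multiplication by inv (r₁! * r₂!).
hEval : ℕ → (ℕ → ℤ) → Poly → Poly → Poly
hEval p inv x y =
  ⊖ psum (p ∸ 1) (λ i →
      const (inv ((suc i) ! ℕ.* (p ∸ suc i) !)) ⊛ (x ^ₚ suc i) ⊛ (y ^ₚ (p ∸ suc i)))

oneMinusX : Poly
oneMinusX = const (+ 1) ⊕ ⊖ X

logSum : ℕ → (ℕ → ℤ) → Poly
logSum p inv = psum (p ∸ 1) (λ i → const (inv (suc i)) ⊛ (X ^ₚ suc i))

-- Write the coefficient of x^n in x^r (1-x)^(p-r) / (r! (p-r)!) as
-- (-1)^(n-r) C(p-r, n-r) / (r! (p-r)!) = (-1)^(n-r) C(n, r) / (n! (p-n)!).
-- For 0 < n < p, summing over r = 1..n and using Σ_r (-1)^r C(n, r) = 0 leaves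
-- (-1)^n / (n! (p-n)!) as the coefficient of x^n in h(x, 1-x), and this is 1/n
-- because Wilson's theorem (p-1)! ≡ -1 gives n! (p-n)! ≡ (-1)^n n.  For n = p the
-- summands for r and p - r cancel when p is odd, and beyond degree p nothing
-- survives.  Wilson's theorem itself comes from pairing each of 1, ..., p-2 with
-- its inverse modulo p.

module Submission where

open import Defs
open import Data.Nat as ℕ using (ℕ; zero; suc; _≤_; _<_; z≤n; s≤s; _!; _∸_)
import Data.Nat.Properties as ℕₚ
open import Data.Nat.Combinatorics
  using (_C_; nCk+nC[k+1]≡[n+1]C[k+1]; k>n⇒nCk≡0; nCn≡1; nCk≡n!/k![n-k]!; k![n∸k]!∣n!)
open import Data.Nat.DivMod using (m/n*n≡m)
open import Data.Nat.Divisibility as ℕ∣ using (_∣_; _∤_; divides)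
open import Data.Nat.ListAction using (product)
open import Data.Nat.Primality
  using (Prime; euclidsLemma; prime⇒nonZero; prime⇒nonTrivial; prime⇒irreducible)
open import Data.Integer as ℤ using (ℤ; +_; _+_; _*_; -_; _-_; -1ℤ; _^_)
import Data.Integer.Properties as ℤₚ
import Data.Integer.DivMod as ℤ÷
import Data.Integer.Divisibility.Signed as ℤ∣
open import Data.Integer.Tactic.RingSolver using (solve; solve-∀)
open import Data.Nat.Tactic.RingSolver using () renaming (solve-∀ to ℕ-solve-∀)
open import Data.List.Base using (List; []; _∷_; filter; length; applyDownFrom)
import Data.List.Properties as Listₚ
open import Data.List.Membership.Propositional using (_∈_)
open import Data.List.Membership.Propositional.Properties
  using (∈-filter⁺; ∈-filter⁻; ∈-applyDownFrom⁺; ∈-applyDownFrom⁻)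
open import Data.List.Relation.Unary.All as All using (All)
open import Data.List.Relation.Unary.Any using (here; there)
open import Data.List.Relation.Unary.Unique.Propositional using (Unique; []; _∷_)
open import Data.List.Relation.Unary.Unique.Propositional.Properties
  using (filter⁺; applyDownFrom⁺₁)
open import Data.Product using (_×_; _,_; proj₁; proj₂)
open import Data.Sum as Sum using (_⊎_; inj₁; inj₂; [_,_])
open import Data.Empty using (⊥; ⊥-elim)
open import Relation.Nullary using (yes; no; ¬?)
open import Relation.Binary.Bundles using (Setoid)
open import Relation.Binary.Definitions using (Decidable; tri<; tri≈; tri>)
open import Relation.Binary.PropositionalEquality hiding ([_])
import Relation.Binary.Reasoning.Setoid as SetoidReasoning
open import Algebra.Properties.CommutativeSemigroup ℕₚ.*-commutativeSemigroup using (x∙yz≈y∙xz)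

module Congruence (m : ℤ) where

  -- Congruence modulo m with an explicit quotient, so that both sides can be
  -- inferred in reasoning chains; ∣⇒≋ and ≋⇒∣ relate it to m ∣ a - b.
  infix 4 _≋_
  record _≋_ (a b : ℤ) : Set where
    constructor ≋-witness
    field
      quotient : ℤ
      equation : a ≡ b + quotient * m

  ≋-refl : ∀ {a} → a ≋ a
  ≋-refl {a} = ≋-witness (+ 0) (solve (a ∷ m ∷ []))

  ≋-reflexive : ∀ {a b} → a ≡ b → a ≋ b
  ≋-reflexive refl = ≋-refl

  ≋-sym : ∀ {a b} → a ≋ b → b ≋ a
  ≋-sym {b = b} (≋-witness q refl) = ≋-witness (- q) (solve (b ∷ q ∷ m ∷ []))

  ≋-trans : ∀ {a b c} → a ≋ b → b ≋ c → a ≋ c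
  ≋-trans {c = c} (≋-witness q refl) (≋-witness r refl) =
    ≋-witness (r + q) (solve (c ∷ q ∷ r ∷ m ∷ []))

  ≋-setoid : Setoid _ _
  ≋-setoid = record
    { Carrier = ℤ
    ; _≈_ = _≋_
    ; isEquivalence = record { refl = ≋-refl ; sym = ≋-sym ; trans = ≋-trans }
    }

  module ≋-Reasoning = SetoidReasoning ≋-setoid

  +-cong : ∀ {a b c d} → a ≋ b → c ≋ d → a + c ≋ b + d
  +-cong {b = b} {d = d} (≋-witness q refl) (≋-witness r refl) =
    ≋-witness (q + r) (solve (b ∷ d ∷ q ∷ r ∷ m ∷ []))

  *-cong : ∀ {a b c d} → a ≋ b → c ≋ d → a * c ≋ b * d
  *-cong {b = b} {d = d} (≋-witness q refl) (≋-witness r refl) =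
    ≋-witness (q * d + b * r + q * r * m) (solve (b ∷ d ∷ q ∷ r ∷ m ∷ []))

  *-congˡ : ∀ c {a b} → a ≋ b → c * a ≋ c * b
  *-congˡ c = *-cong (≋-refl {c})

  *-congʳ : ∀ c {a b} → a ≋ b → a * c ≋ b * c
  *-congʳ c a≋b = *-cong a≋b (≋-refl {c})

  neg-cong : ∀ {a b} → a ≋ b → - a ≋ - b
  neg-cong {b = b} (≋-witness q refl) = ≋-witness (- q) (solve (b ∷ q ∷ m ∷ []))

  m≋0 : m ≋ + 0
  m≋0 = ≋-witness (+ 1) (solve (m ∷ []))

  ∣⇒≋ : ∀ {a b} → m ℤ∣.∣ (a - b) → a ≋ b
  ∣⇒≋ {a} {b} (ℤ∣.divides q a-b≡qm) = ≋-witness q (begin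
    a               ≡⟨ solve (a ∷ b ∷ []) ⟩
    b + (a - b)     ≡⟨ cong (λ d → b + d) a-b≡qm ⟩
    b + q * m       ∎)
    where open ≡-Reasoning

  ≋⇒∣ : ∀ {a b} → a ≋ b → m ℤ∣.∣ (a - b)
  ≋⇒∣ {b = b} (≋-witness q refl) = ℤ∣.divides q (solve (b ∷ q ∷ m ∷ []))

  sum-cong-≋ : ∀ n {f g} → (∀ i → i < n → f i ≋ g i) → sumℤ n f ≋ sumℤ n g
  sum-cong-≋ zero    f≋g = ≋-refl
  sum-cong-≋ (suc n) f≋g =
    +-cong (sum-cong-≋ n (λ i i<n → f≋g i (ℕₚ.m<n⇒m<1+n i<n))) (f≋g n ℕₚ.≤-refl)

module FiniteSums where

  open ≡-Reasoning

  sum-cong : ∀ n {f g} → (∀ i → i < n → f i ≡ g i) → sumℤ n f ≡ sumℤ n g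
  sum-cong zero    f≡g = refl
  sum-cong (suc n) f≡g =
    cong₂ _+_ (sum-cong n (λ i i<n → f≡g i (ℕₚ.m<n⇒m<1+n i<n))) (f≡g n ℕₚ.≤-refl)

  sum-zero : ∀ n {f} → (∀ i → i < n → f i ≡ + 0) → sumℤ n f ≡ + 0
  sum-zero zero    f≡0 = refl
  sum-zero (suc n) f≡0 =
    cong₂ _+_ (sum-zero n (λ i i<n → f≡0 i (ℕₚ.m<n⇒m<1+n i<n))) (f≡0 n ℕₚ.≤-refl)

  sum-suc : ∀ n f → sumℤ (suc n) f ≡ f 0 + sumℤ n (λ i → f (suc i))
  sum-suc zero    f = ℤₚ.+-comm (+ 0) (f 0)
  sum-suc (suc n) f = begin
    sumℤ (suc n) f + f (suc n)                   ≡⟨ cong (_+ f (suc n)) (sum-suc n f) ⟩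
    f 0 + sumℤ n (λ i → f (suc i)) + f (suc n)   ≡⟨ ℤₚ.+-assoc (f 0) _ _ ⟩
    f 0 + (sumℤ n (λ i → f (suc i)) + f (suc n)) ∎

  sum-truncate : ∀ m n {f} → m ≤ n → (∀ i → m ≤ i → i < n → f i ≡ + 0) →
                 sumℤ n f ≡ sumℤ m f
  sum-truncate m zero    z≤n f≡0 = refl
  sum-truncate m (suc n) {f} m≤1+n f≡0 with ℕₚ.m≤n⇒m<n∨m≡n m≤1+n
  ... | inj₂ refl      = refl
  ... | inj₁ (s≤s m≤n) = begin
    sumℤ n f + f n ≡⟨ cong₂ _+_ (sum-truncate m n m≤n (λ i m≤i i<n → f≡0 i m≤i (ℕₚ.m<n⇒m<1+n i<n)))
                                (f≡0 n m≤n ℕₚ.≤-refl) ⟩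
    sumℤ m f + + 0 ≡⟨ ℤₚ.+-identityʳ _ ⟩
    sumℤ m f       ∎

  sum-single : ∀ n k {f} → k < n → (∀ i → i < n → i ≢ k → f i ≡ + 0) → sumℤ n f ≡ f k
  sum-single (suc n) k {f} k<1+n f≡0 with k ℕ.≟ n
  ... | yes refl = begin
    sumℤ k f + f k ≡⟨ cong (_+ f k) (sum-zero k (λ i i<k → f≡0 i (ℕₚ.m<n⇒m<1+n i<k) (ℕₚ.<⇒≢ i<k))) ⟩
    + 0 + f k      ≡⟨ ℤₚ.+-identityˡ _ ⟩
    f k            ∎
  ... | no k≢n = begin
    sumℤ n f + f n ≡⟨ cong₂ _+_ (sum-single n k (ℕₚ.≤∧≢⇒< (ℕₚ.≤-pred k<1+n) k≢n)
                                              (λ i i<n → f≡0 i (ℕₚ.m<n⇒m<1+n i<n)))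
                                (f≡0 n ℕₚ.≤-refl (≢-sym k≢n)) ⟩
    f k + + 0      ≡⟨ ℤₚ.+-identityʳ _ ⟩
    f k            ∎

  sum-*ˡ : ∀ n c f → sumℤ n (λ i → c * f i) ≡ c * sumℤ n f
  sum-*ˡ zero    c f = sym (ℤₚ.*-zeroʳ c)
  sum-*ˡ (suc n) c f = trans (cong (_+ c * f n) (sum-*ˡ n c f)) (sym (ℤₚ.*-distribˡ-+ c _ _))

  sum-neg : ∀ n f → sumℤ n (λ i → - f i) ≡ - sumℤ n f
  sum-neg zero    f = refl
  sum-neg (suc n) f = trans (cong (_+ - f n) (sum-neg n f)) (sym (ℤₚ.neg-distrib-+ (sumℤ n f) (f n)))

  sum-reverse : ∀ n f → sumℤ n f ≡ sumℤ n (λ i → f (n ∸ suc i))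
  sum-reverse zero    f = refl
  sum-reverse (suc n) f = begin
    sumℤ n f + f n                           ≡⟨ cong (_+ f n) (sum-reverse n f) ⟩
    sumℤ n (λ i → f (n ∸ suc i)) + f n       ≡⟨ ℤₚ.+-comm _ (f n) ⟩
    f n + sumℤ n (λ i → f (n ∸ suc i))       ≡⟨ sum-suc n (λ i → f (suc n ∸ suc i)) ⟨
    sumℤ (suc n) (λ i → f (suc n ∸ suc i))   ∎

  x≡-x⇒x≡0 : ∀ {x} → x ≡ - x → x ≡ + 0
  x≡-x⇒x≡0 {+ zero} _ = refl

  sum-antisymmetric : ∀ n {f} → (∀ i → i < n → f (n ∸ suc i) ≡ - f i) → sumℤ n f ≡ + 0
  sum-antisymmetric n {f} f-antisym = x≡-x⇒x≡0 (begin
    sumℤ n f                          ≡⟨ sum-reverse n f ⟩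
    sumℤ n (λ i → f (n ∸ suc i))      ≡⟨ sum-cong n f-antisym ⟩
    sumℤ n (λ i → - f i)              ≡⟨ sum-neg n f ⟩
    - sumℤ n f                        ∎)

open FiniteSums

module Coefficients where

  open ≡-Reasoning

  psum-coeff : ∀ N F n → psum N F n ≡ sumℤ N (λ i → F i n)
  psum-coeff zero    F zero    = refl
  psum-coeff zero    F (suc n) = refl
  psum-coeff (suc N) F n       = cong (_+ F N n) (psum-coeff N F n)

  const-⊛-coeff : ∀ c f n → (const c ⊛ f) n ≡ c * f n
  const-⊛-coeff c f n = begin
    sumℤ (suc n) (λ i → const c i * f (n ∸ i))       ≡⟨ sum-suc n _ ⟩
    c * f n + sumℤ n (λ i → + 0 * f (n ∸ suc i))     ≡⟨ cong (λ s → c * f n + s)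
                                                          (sum-zero n (λ i _ → ℤₚ.*-zeroˡ (f (n ∸ suc i)))) ⟩
    c * f n + + 0                                    ≡⟨ ℤₚ.+-identityʳ _ ⟩
    c * f n                                          ∎

  [1+n]∸i≡2+[n∸[1+i]] : ∀ {i n} → i < n → suc n ∸ i ≡ suc (suc (n ∸ suc i))
  [1+n]∸i≡2+[n∸[1+i]] {zero}  {suc n} _         = refl
  [1+n]∸i≡2+[n∸[1+i]] {suc i} {suc n} (s≤s i<n) = [1+n]∸i≡2+[n∸[1+i]] i<n

  ⊛-coeff-zero : ∀ f g → (f ⊛ g) 0 ≡ f 0 * g 0
  ⊛-coeff-zero f g = ℤₚ.+-identityˡ _

  ⊛-linear-coeff-suc : ∀ f g → (∀ k → g (suc (suc k)) ≡ + 0) →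
                       ∀ n → (f ⊛ g) (suc n) ≡ f n * g 1 + f (suc n) * g 0
  ⊛-linear-coeff-suc f g g≡0 n = begin
    sumℤ n (λ i → f i * g (suc n ∸ i)) + f n * g (suc n ∸ n) + f (suc n) * g (n ∸ n)
      ≡⟨ cong (λ s → s + f n * g (suc n ∸ n) + f (suc n) * g (n ∸ n)) (sum-zero n low-terms) ⟩
    + 0 + f n * g (suc n ∸ n) + f (suc n) * g (n ∸ n)
      ≡⟨ cong₂ (λ a b → + 0 + f n * g a + f (suc n) * g b) (ℕₚ.m+n∸n≡m 1 n) (ℕₚ.n∸n≡0 n) ⟩
    + 0 + f n * g 1 + f (suc n) * g 0
      ≡⟨ cong (_+ f (suc n) * g 0) (ℤₚ.+-identityˡ (f n * g 1)) ⟩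
    f n * g 1 + f (suc n) * g 0 ∎
    where
    low-terms : ∀ i → i < n → f i * g (suc n ∸ i) ≡ + 0
    low-terms i i<n = begin
      f i * g (suc n ∸ i)              ≡⟨ cong (λ k → f i * g k) ([1+n]∸i≡2+[n∸[1+i]] i<n) ⟩
      f i * g (suc (suc (n ∸ suc i)))  ≡⟨ cong (f i *_) (g≡0 _) ⟩
      f i * + 0                        ≡⟨ ℤₚ.*-zeroʳ (f i) ⟩
      + 0                              ∎

  ⊛X-coeff-zero : ∀ f → (f ⊛ X) 0 ≡ + 0
  ⊛X-coeff-zero f = trans (⊛-coeff-zero f X) (ℤₚ.*-zeroʳ (f 0))

  ⊛X-coeff-suc : ∀ f n → (f ⊛ X) (suc n) ≡ f n
  ⊛X-coeff-suc f n = trans (⊛-linear-coeff-suc f X (λ _ → refl) n) (simplify (f n) (f (suc n)))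
    where
    simplify : ∀ a b → a * + 1 + b * + 0 ≡ a
    simplify = solve-∀

  ⊛oneMinusX-coeff-zero : ∀ f → (f ⊛ oneMinusX) 0 ≡ f 0
  ⊛oneMinusX-coeff-zero f = trans (⊛-coeff-zero f oneMinusX) (ℤₚ.*-identityʳ (f 0))

  ⊛oneMinusX-coeff-suc : ∀ f n → (f ⊛ oneMinusX) (suc n) ≡ f (suc n) - f n
  ⊛oneMinusX-coeff-suc f n =
    trans (⊛-linear-coeff-suc f oneMinusX (λ _ → refl) n) (simplify (f n) (f (suc n)))
    where
    simplify : ∀ a b → a * -1ℤ + b * + 1 ≡ b - a
    simplify = solve-∀

  X^-coeff-diag : ∀ k → (X ^ₚ k) k ≡ + 1
  X^-coeff-diag zero    = refl
  X^-coeff-diag (suc k) = trans (⊛X-coeff-suc (X ^ₚ k) k) (X^-coeff-diag k)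

  X^-coeff-off : ∀ k n → n ≢ k → (X ^ₚ k) n ≡ + 0
  X^-coeff-off zero    zero    0≢0   = ⊥-elim (0≢0 refl)
  X^-coeff-off zero    (suc n) _     = refl
  X^-coeff-off (suc k) zero    _     = ⊛X-coeff-zero (X ^ₚ k)
  X^-coeff-off (suc k) (suc n) n+1≢k+1 =
    trans (⊛X-coeff-suc (X ^ₚ k) n) (X^-coeff-off k n (λ n≡k → n+1≢k+1 (cong suc n≡k)))

  monomial-coeff-diag : ∀ c k → (const c ⊛ X ^ₚ k) k ≡ c
  monomial-coeff-diag c k =
    trans (const-⊛-coeff c (X ^ₚ k) k) (trans (cong (c *_) (X^-coeff-diag k)) (ℤₚ.*-identityʳ c))

  monomial-coeff-off : ∀ c k n → n ≢ k → (const c ⊛ X ^ₚ k) n ≡ + 0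
  monomial-coeff-off c k n n≢k =
    trans (const-⊛-coeff c (X ^ₚ k) n) (trans (cong (c *_) (X^-coeff-off k n n≢k)) (ℤₚ.*-zeroʳ c))

  monomial-⊛-coeff : ∀ c k g n → k ≤ n → (const c ⊛ X ^ₚ k ⊛ g) n ≡ c * g (n ∸ k)
  monomial-⊛-coeff c k g n k≤n = begin
    sumℤ (suc n) (λ i → (const c ⊛ X ^ₚ k) i * g (n ∸ i))
      ≡⟨ sum-single (suc n) k (s≤s k≤n) (λ i _ i≢k →
           trans (cong (_* g (n ∸ i)) (monomial-coeff-off c k i i≢k)) (ℤₚ.*-zeroˡ (g (n ∸ i)))) ⟩
    (const c ⊛ X ^ₚ k) k * g (n ∸ k)
      ≡⟨ cong (_* g (n ∸ k)) (monomial-coeff-diag c k) ⟩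
    c * g (n ∸ k) ∎

  monomial-⊛-coeff-< : ∀ c k g n → n < k → (const c ⊛ X ^ₚ k ⊛ g) n ≡ + 0
  monomial-⊛-coeff-< c k g n n<k = sum-zero (suc n) λ i i<1+n →
    trans (cong (_* g (n ∸ i)) (monomial-coeff-off c k i (≢k i<1+n))) (ℤₚ.*-zeroˡ (g (n ∸ i)))
    where
    ≢k : ∀ {i} → i < suc n → i ≢ k
    ≢k i<1+n i≡k = ℕₚ.<⇒≱ n<k (subst (_≤ n) i≡k (ℕₚ.≤-pred i<1+n))

  sum-coeff-⊛oneMinusX : ∀ f N → sumℤ (suc N) (f ⊛ oneMinusX) ≡ f N
  sum-coeff-⊛oneMinusX f zero    = trans (ℤₚ.+-identityˡ _) (⊛oneMinusX-coeff-zero f)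
  sum-coeff-⊛oneMinusX f (suc N) = begin
    sumℤ (suc N) (f ⊛ oneMinusX) + (f ⊛ oneMinusX) (suc N)
      ≡⟨ cong₂ _+_ (sum-coeff-⊛oneMinusX f N) (⊛oneMinusX-coeff-suc f N) ⟩
    f N + (f (suc N) - f N)
      ≡⟨ cancel (f N) (f (suc N)) ⟩
    f (suc N) ∎
    where
    cancel : ∀ a b → a + (b - a) ≡ b
    cancel = solve-∀

  oneMinusX^-coeff : ∀ m j → (oneMinusX ^ₚ m) j ≡ -1ℤ ^ j * + (m C j)
  oneMinusX^-coeff zero    zero    = refl
  oneMinusX^-coeff zero    (suc j) = begin
    + 0                          ≡⟨ ℤₚ.*-zeroʳ (-1ℤ ^ suc j) ⟨
    -1ℤ ^ suc j * + 0            ≡⟨ cong (λ c → -1ℤ ^ suc j * + c) (k>n⇒nCk≡0 {0} {suc j} (s≤s z≤n)) ⟨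
    -1ℤ ^ suc j * + (0 C suc j)  ∎
  oneMinusX^-coeff (suc m) zero    =
    trans (⊛oneMinusX-coeff-zero (oneMinusX ^ₚ m)) (oneMinusX^-coeff m zero)
  oneMinusX^-coeff (suc m) (suc j) = begin
    (oneMinusX ^ₚ m ⊛ oneMinusX) (suc j)
      ≡⟨ ⊛oneMinusX-coeff-suc (oneMinusX ^ₚ m) j ⟩
    (oneMinusX ^ₚ m) (suc j) - (oneMinusX ^ₚ m) j
      ≡⟨ cong₂ _-_ (oneMinusX^-coeff m (suc j)) (oneMinusX^-coeff m j) ⟩
    -1ℤ * s * + (m C suc j) - s * + (m C j)
      ≡⟨ cong (λ t → t * + (m C suc j) - s * + (m C j)) (ℤₚ.-1*i≡-i s) ⟩
    - s * + (m C suc j) - s * + (m C j)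
      ≡⟨ factor s (+ (m C suc j)) (+ (m C j)) ⟩
    - s * (+ (m C j) + + (m C suc j))
      ≡⟨ cong₂ (λ t c → t * c) (ℤₚ.-1*i≡-i s) (ℤₚ.pos-+ (m C j) (m C suc j)) ⟨
    -1ℤ * s * + (m C j ℕ.+ m C suc j)
      ≡⟨ cong (λ c → -1ℤ ^ suc j * + c) (nCk+nC[k+1]≡[n+1]C[k+1] m j) ⟩
    -1ℤ ^ suc j * + (suc m C suc j) ∎
    where
    s = -1ℤ ^ j
    factor : ∀ s a b → - s * a - s * b ≡ - s * (b + a)
    factor = solve-∀

  oneMinusX^-coeff-> : ∀ m j → m < j → (oneMinusX ^ₚ m) j ≡ + 0
  oneMinusX^-coeff-> m j m<j = begin
    (oneMinusX ^ₚ m) j   ≡⟨ oneMinusX^-coeff m j ⟩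
    -1ℤ ^ j * + (m C j)  ≡⟨ cong (λ c → -1ℤ ^ j * + c) (k>n⇒nCk≡0 m<j) ⟩
    -1ℤ ^ j * + 0        ≡⟨ ℤₚ.*-zeroʳ (-1ℤ ^ j) ⟩
    + 0                  ∎

  oneMinusX^-coeff-diag : ∀ m → (oneMinusX ^ₚ m) m ≡ -1ℤ ^ m
  oneMinusX^-coeff-diag m = begin
    (oneMinusX ^ₚ m) m   ≡⟨ oneMinusX^-coeff m m ⟩
    -1ℤ ^ m * + (m C m)  ≡⟨ cong (λ c → -1ℤ ^ m * + c) (nCn≡1 m) ⟩
    -1ℤ ^ m * + 1        ≡⟨ ℤₚ.*-identityʳ (-1ℤ ^ m) ⟩
    -1ℤ ^ m              ∎

  sum-coeff-oneMinusX^ : ∀ k → sumℤ (suc k) (λ i → (oneMinusX ^ₚ suc k) (suc i)) ≡ -1ℤ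
  sum-coeff-oneMinusX^ k = begin
    S                                        ≡⟨ shift S ⟩
    + 1 + S - + 1                            ≡⟨ cong (λ c → c + S - + 1) (oneMinusX^-coeff (suc k) 0) ⟨
    (oneMinusX ^ₚ suc k) 0 + S - + 1         ≡⟨ cong (_- + 1) (sum-suc (suc k) (oneMinusX ^ₚ suc k)) ⟨
    sumℤ (suc (suc k)) (oneMinusX ^ₚ suc k) - + 1
      ≡⟨ cong (_- + 1) (sum-coeff-⊛oneMinusX (oneMinusX ^ₚ k) (suc k)) ⟩
    (oneMinusX ^ₚ k) (suc k) - + 1           ≡⟨ cong (_- + 1) (oneMinusX^-coeff-> k (suc k) ℕₚ.≤-refl) ⟩
    -1ℤ                                      ∎
    where
    S = sumℤ (suc k) (λ i → (oneMinusX ^ₚ suc k) (suc i))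
    shift : ∀ s → s ≡ + 1 + s - + 1
    shift = solve-∀

  nCk*k!*[n∸k]!≡n! : ∀ {n k} → k ≤ n → (n C k) ℕ.* (k ! ℕ.* (n ∸ k) !) ≡ n !
  nCk*k!*[n∸k]!≡n! {n} {k} k≤n =
    trans (cong (ℕ._* (k ! ℕ.* (n ∸ k) !)) (nCk≡n!/k![n-k]! k≤n)) (m/n*n≡m (k![n∸k]!∣n! k≤n))
    where instance _ = k ℕₚ.!* (n ∸ k) !≢0

open Coefficients

module Signs where

  open ≡-Reasoning

  -1^-square : ∀ n → -1ℤ ^ n * -1ℤ ^ n ≡ + 1
  -1^-square zero    = refl
  -1^-square (suc n) = begin
    -1ℤ * s * (-1ℤ * s)   ≡⟨ cong₂ _*_ (ℤₚ.-1*i≡-i s) (ℤₚ.-1*i≡-i s) ⟩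
    - s * - s             ≡⟨ neg-square s ⟩
    s * s                 ≡⟨ -1^-square n ⟩
    + 1                   ∎
    where
    s = -1ℤ ^ n
    neg-square : ∀ s → - s * - s ≡ s * s
    neg-square = solve-∀

  -1^-* : ∀ {m n} → m ≤ n → -1ℤ ^ n * -1ℤ ^ m ≡ -1ℤ ^ (n ∸ m)
  -1^-* {m} {n} m≤n = begin
    -1ℤ ^ n * sᵐ                     ≡⟨ cong (λ k → -1ℤ ^ k * sᵐ) (ℕₚ.m+[n∸m]≡n m≤n) ⟨
    -1ℤ ^ (m ℕ.+ (n ∸ m)) * sᵐ       ≡⟨ cong (_* sᵐ) (ℤₚ.^-distribˡ-+-* -1ℤ m (n ∸ m)) ⟩
    sᵐ * -1ℤ ^ (n ∸ m) * sᵐ          ≡⟨ swap sᵐ (-1ℤ ^ (n ∸ m)) ⟩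
    sᵐ * sᵐ * -1ℤ ^ (n ∸ m)          ≡⟨ cong (_* -1ℤ ^ (n ∸ m)) (-1^-square m) ⟩
    + 1 * -1ℤ ^ (n ∸ m)              ≡⟨ ℤₚ.*-identityˡ _ ⟩
    -1ℤ ^ (n ∸ m)                    ∎
    where
    sᵐ = -1ℤ ^ m
    swap : ∀ a b → a * b * a ≡ a * a * b
    swap = solve-∀

  -1^-complement : ∀ {m n} → m ≤ n → -1ℤ ^ n ≡ -1ℤ → -1ℤ ^ m ≡ - -1ℤ ^ (n ∸ m)
  -1^-complement {m} {n} m≤n -1^n≡-1 = begin
    -1ℤ ^ m                  ≡⟨ ℤₚ.neg-involutive (-1ℤ ^ m) ⟨
    - (- -1ℤ ^ m)            ≡⟨ cong -_ (ℤₚ.-1*i≡-i (-1ℤ ^ m)) ⟨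
    - (-1ℤ * -1ℤ ^ m)        ≡⟨ cong (λ s → - (s * -1ℤ ^ m)) -1^n≡-1 ⟨
    - (-1ℤ ^ n * -1ℤ ^ m)    ≡⟨ cong -_ (-1^-* m≤n) ⟩
    - -1ℤ ^ (n ∸ m)          ∎

  2∣n⊎-1^n≡-1 : ∀ n → 2 ∣ n ⊎ -1ℤ ^ n ≡ -1ℤ
  2∣n⊎-1^n≡-1 zero          = inj₁ (2 ℕ∣.∣0)
  2∣n⊎-1^n≡-1 (suc zero)    = inj₂ refl
  2∣n⊎-1^n≡-1 (suc (suc n)) =
    Sum.map (ℕ∣.∣m∣n⇒∣m+n ℕ∣.∣-refl) (cong (λ s → -1ℤ * (-1ℤ * s))) (2∣n⊎-1^n≡-1 n)

  -1^-odd-prime : ∀ {p} → Prime p → p ≢ 2 → -1ℤ ^ p ≡ -1ℤ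
  -1^-odd-prime {p} p-prime p≢2 with 2∣n⊎-1^n≡-1 p
  ... | inj₂ -1^p≡-1 = -1^p≡-1
  ... | inj₁ 2∣p with prime⇒irreducible p-prime 2∣p
  ...   | inj₂ 2≡p = ⊥-elim (p≢2 (sym 2≡p))

open Signs

module ListProducts where

  open ≡-Reasoning

  product-applyDownFrom-suc : ∀ n → product (applyDownFrom suc n) ≡ n !
  product-applyDownFrom-suc zero    = refl
  product-applyDownFrom-suc (suc n) = cong (suc n ℕ.*_) (product-applyDownFrom-suc n)

  _≢?_ : Decidable {A = ℕ} _≢_
  x ≢? b = ¬? (x ℕ.≟ b)

  without : ℕ → List ℕ → List ℕ
  without b = filter (_≢? b)

  product-without : ∀ {b L} → Unique L → b ∈ L → product L ≡ b ℕ.* product (without b L)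
  product-without {b} {b ∷ L} (b∉L ∷ _) (here refl) = cong (b ℕ.*_) (sym (begin
    product (without b (b ∷ L)) ≡⟨ cong product (Listₚ.filter-reject (_≢? b) (λ b≢b → b≢b refl)) ⟩
    product (without b L)       ≡⟨ cong product (Listₚ.filter-all (_≢? b) (All.map ≢-sym b∉L)) ⟩
    product L                   ∎))
  product-without {b} {a ∷ L} (a∉L ∷ unique-L) (there b∈L) with a ℕ.≟ b
  ... | yes refl = ⊥-elim (All.lookup a∉L b∈L refl)
  ... | no a≢b = begin
    a ℕ.* product L                           ≡⟨ cong (a ℕ.*_) (product-without unique-L b∈L) ⟩
    a ℕ.* (b ℕ.* product (without b L))       ≡⟨ x∙yz≈y∙xz a b _ ⟩
    b ℕ.* (a ℕ.* product (without b L))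
      ≡⟨ cong (λ l → b ℕ.* product l) (Listₚ.filter-accept (_≢? b) a≢b) ⟨
    b ℕ.* product (without b (a ∷ L))         ∎

open ListProducts

module PairedProducts (m : ℤ) where

  open Congruence m

  record PairedIn (L : List ℕ) (j : ℕ → ℕ) (x : ℕ) : Set where
    field
      partner-∈  : j x ∈ L
      involutive : j (j x) ≡ x
      inverse    : + x * + j x ≋ + 1
      fixed⇒≋1   : j x ≡ x → + x ≋ + 1
  open PairedIn

  product-paired : ∀ j {L} → Unique L → (∀ {x} → x ∈ L → PairedIn L j x) → + product L ≋ + 1
  product-paired j {L} = go (length L) ℕₚ.≤-refl
    where
    open ≋-Reasoning

    go : ∀ n {L} → length L ≤ n → Unique L → (∀ {x} → x ∈ L → PairedIn L j x) → + product L ≋ + 1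
    go _       {[]}    _          _                  _      = ≋-refl
    go (suc n) {a ∷ L} (s≤s |L|≤n) (a∉L ∷ unique-L) paired with j a ℕ.≟ a
    ... | yes ja≡a = begin
      + (a ℕ.* product L)   ≡⟨ ℤₚ.pos-* a (product L) ⟩
      + a * + product L     ≈⟨ *-cong (fixed⇒≋1 (paired (here refl)) ja≡a) (go n |L|≤n unique-L paired-L) ⟩
      + 1                   ∎
      where
      paired-L : ∀ {x} → x ∈ L → PairedIn L j x
      paired-L {x} x∈L = record
        { partner-∈  = partner-∈L (partner-∈ px)
        ; involutive = involutive px
        ; inverse    = inverse px
        ; fixed⇒≋1   = fixed⇒≋1 px
        }
        where
        px = paired (there x∈L)
        partner-∈L : j x ∈ a ∷ L → j x ∈ L
        partner-∈L (here jx≡a)  =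
          ⊥-elim (All.lookup a∉L x∈L (trans (sym ja≡a) (trans (cong j (sym jx≡a)) (involutive px))))
        partner-∈L (there jx∈L) = jx∈L
    ... | no ja≢a = begin
      + (a ℕ.* product L)                  ≡⟨ cong (λ r → + (a ℕ.* r)) (product-without unique-L b∈L) ⟩
      + (a ℕ.* (b ℕ.* product L′))         ≡⟨ cong +_ (ℕₚ.*-assoc a b (product L′)) ⟨
      + (a ℕ.* b ℕ.* product L′)           ≡⟨ ℤₚ.pos-* (a ℕ.* b) (product L′) ⟩
      + (a ℕ.* b) * + product L′           ≡⟨ cong (_* + product L′) (ℤₚ.pos-* a b) ⟩
      + a * + b * + product L′
        ≈⟨ *-cong (inverse (paired (here refl))) (go n |L′|≤n unique-L′ paired-L′) ⟩
      + 1                                  ∎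
      where
      b = j a
      L′ = without b L
      b∈L : b ∈ L
      b∈L with partner-∈ (paired (here refl))
      ... | here ja≡a = ⊥-elim (ja≢a ja≡a)
      ... | there ja∈L = ja∈L
      |L′|≤n : length L′ ≤ n
      |L′|≤n = ℕₚ.≤-trans (Listₚ.length-filter (_≢? b) L) |L|≤n
      unique-L′ : Unique L′
      unique-L′ = filter⁺ (_≢? b) unique-L
      paired-L′ : ∀ {x} → x ∈ L′ → PairedIn L′ j x
      paired-L′ {x} x∈L′ = record
        { partner-∈  = ∈-filter⁺ (_≢? b) (partner-∈L (partner-∈ px)) jx≢b
        ; involutive = involutive px
        ; inverse    = inverse px
        ; fixed⇒≋1   = fixed⇒≋1 px
        }
        where
        x∈L = proj₁ (∈-filter⁻ (_≢? b) {xs = L} x∈L′)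
        x≢b = proj₂ (∈-filter⁻ (_≢? b) {xs = L} x∈L′)
        px = paired (there x∈L)
        jx≢b : j x ≢ b
        jx≢b jx≡b = All.lookup a∉L x∈L
          (trans (sym (involutive (paired (here refl)))) (trans (cong j (sym jx≡b)) (involutive px)))
        partner-∈L : j x ∈ a ∷ L → j x ∈ L
        partner-∈L (here jx≡a)  = ⊥-elim (x≢b (trans (sym (involutive px)) (cong j jx≡a)))
        partner-∈L (there jx∈L) = jx∈L

module PrimeModulus (p : ℕ) (p-prime : Prime p) (inv : ℕ → ℤ) (inv-correct : IsInverseMod p inv) where

  open Congruence (+ p) public
  open ≋-Reasoning

  instance
    p≢0 : ℕ.NonZero p
    p≢0 = prime⇒nonZero p-prime

  1<p : 1 < p
  1<p = ℕ.nonTrivial⇒n>1 p {{prime⇒nonTrivial p-prime}}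

  0<n<p⇒p∤n : ∀ {n} → 0 < n → n < p → p ∤ n
  0<n<p⇒p∤n {suc n} _ = ℕ∣.>⇒∤

  p∸1<p : p ∸ 1 < p
  p∸1<p = ℕₚ.∸-monoʳ-< {o = 0} (s≤s z≤n) (ℕₚ.<⇒≤ 1<p)

  p∤* : ∀ {a b} → p ∤ a → p ∤ b → p ∤ a ℕ.* b
  p∤* {a} {b} p∤a p∤b p∣ab = [ p∤a , p∤b ] (euclidsLemma a b p-prime p∣ab)

  p∤n! : ∀ {n} → n < p → p ∤ n !
  p∤n! {zero}  _     = 0<n<p⇒p∤n (s≤s z≤n) 1<p
  p∤n! {suc n} n+1<p = p∤* (0<n<p⇒p∤n (s≤s z≤n) n+1<p) (p∤n! (ℕₚ.<⇒≤ n+1<p))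

  ≋⇒ModEq : ∀ {a b} → a ≋ b → ModEq p a b
  ≋⇒ModEq a≋b = ℤ∣.∣⇒∣ᵤ (≋⇒∣ a≋b)

  inv-inverse : ∀ {a} → p ∤ a → inv a * + a ≋ + 1
  inv-inverse {a} p∤a = ∣⇒≋ (ℤ∣.∣ᵤ⇒∣ (inv-correct a p∤a))

  inv-cancel : ∀ {a} → p ∤ a → ∀ x → inv a * + a * x ≋ x
  inv-cancel p∤a x = ≋-trans (*-congʳ x (inv-inverse p∤a)) (≋-reflexive (ℤₚ.*-identityˡ x))

  *-cancelʳ-≋ : ∀ {a x y} → p ∤ a → x * + a ≋ y * + a → x ≋ y
  *-cancelʳ-≋ {a} {x} {y} p∤a xa≋ya = begin
    x                    ≈⟨ inv-cancel p∤a x ⟨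
    inv a * + a * x      ≡⟨ rotate (inv a) (+ a) x ⟩
    x * + a * inv a      ≈⟨ *-congʳ (inv a) xa≋ya ⟩
    y * + a * inv a      ≡⟨ rotate (inv a) (+ a) y ⟨
    inv a * + a * y      ≈⟨ inv-cancel p∤a y ⟩
    y                    ∎
    where
    rotate : ∀ i a x → i * a * x ≡ x * a * i
    rotate = solve-∀

  inv-unique : ∀ {a x} → p ∤ a → x * + a ≋ + 1 → x ≋ inv a
  inv-unique p∤a xa≋1 = *-cancelʳ-≋ p∤a (≋-trans xa≋1 (≋-sym (inv-inverse p∤a)))

  inv1≋1 : inv 1 ≋ + 1
  inv1≋1 = ≋-sym (inv-unique (0<n<p⇒p∤n (s≤s z≤n) 1<p) ≋-refl)

  inv-* : ∀ {a b} → p ∤ a → p ∤ b → inv (a ℕ.* b) ≋ inv a * inv b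
  inv-* {a} {b} p∤a p∤b = ≋-sym (inv-unique (p∤* p∤a p∤b) (begin
    inv a * inv b * + (a ℕ.* b)      ≡⟨ cong (inv a * inv b *_) (ℤₚ.pos-* a b) ⟩
    inv a * inv b * (+ a * + b)      ≡⟨ regroup (inv a) (inv b) (+ a) (+ b) ⟩
    inv a * + a * (inv b * + b)      ≈⟨ *-cong (inv-inverse p∤a) (inv-inverse p∤b) ⟩
    + 1                              ∎))
    where
    regroup : ∀ x y a b → x * y * (a * b) ≡ x * a * (y * b)
    regroup = solve-∀

  binomial-over-factorial : ∀ {n k} → n < p → k ≤ n → + (n C k) * inv (n !) ≋ inv (k !) * inv ((n ∸ k) !)
  binomial-over-factorial {n} {k} n<p k≤n = begin
    c * inv (n !)
      ≈⟨ inv-cancel p∤k! _ ⟨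
    inv (k !) * + (k !) * (c * inv (n !))
      ≈⟨ inv-cancel p∤[n∸k]! _ ⟨
    inv ((n ∸ k) !) * + ((n ∸ k) !) * (inv (k !) * + (k !) * (c * inv (n !)))
      ≡⟨ regroup c (inv (n !)) (inv (k !)) (+ (k !)) (inv ((n ∸ k) !)) (+ ((n ∸ k) !)) ⟩
    c * (+ (k !) * + ((n ∸ k) !)) * inv (n !) * (inv (k !) * inv ((n ∸ k) !))
      ≡⟨ cong (λ c → c * inv (n !) * (inv (k !) * inv ((n ∸ k) !))) c*k!*[n∸k]!≡n! ⟩
    + (n !) * inv (n !) * (inv (k !) * inv ((n ∸ k) !))
      ≡⟨ cong (_* (inv (k !) * inv ((n ∸ k) !))) (ℤₚ.*-comm (+ (n !)) (inv (n !))) ⟩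
    inv (n !) * + (n !) * (inv (k !) * inv ((n ∸ k) !))
      ≈⟨ inv-cancel (p∤n! n<p) _ ⟩
    inv (k !) * inv ((n ∸ k) !) ∎
    where
    c = + (n C k)
    p∤k! = p∤n! (ℕₚ.≤-<-trans k≤n n<p)
    p∤[n∸k]! = p∤n! (ℕₚ.≤-<-trans (ℕₚ.m∸n≤m n k) n<p)
    c*k!*[n∸k]!≡n! : c * (+ (k !) * + ((n ∸ k) !)) ≡ + (n !)
    c*k!*[n∸k]!≡n! = trans (cong (c *_) (sym (ℤₚ.pos-* (k !) ((n ∸ k) !))))
                    (trans (sym (ℤₚ.pos-* (n C k) _)) (cong +_ (nCk*k!*[n∸k]!≡n! k≤n)))
    regroup : ∀ c i x k y l → y * l * (x * k * (c * i)) ≡ c * (k * l) * i * (x * y)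
    regroup = solve-∀

  ∣⇒≋0 : ∀ {a} → p ∣ a → + a ≋ + 0
  ∣⇒≋0 (divides q refl) = ≋-witness (+ q) (trans (ℤₚ.pos-* q p) (sym (ℤₚ.+-identityˡ _)))

  ≋0⇒∣ : ∀ {a} → + a ≋ + 0 → p ∣ a
  ≋0⇒∣ {a} a≋0 = subst (p ∣_) (ℕₚ.+-identityʳ a) (ℤ∣.∣⇒∣ᵤ (≋⇒∣ a≋0))

  ∣∧<⇒≡0 : ∀ {a} → p ∣ a → a < p → a ≡ 0
  ∣∧<⇒≡0 {zero}  _   _   = refl
  ∣∧<⇒≡0 {suc a} p∣a a<p = ⊥-elim (ℕ∣.>⇒∤ a<p p∣a)

  ≋∧≤⇒≥ : ∀ {a b} → a ≤ b → b < p → + a ≋ + b → b ≤ a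
  ≋∧≤⇒≥ {a} {b} a≤b b<p a≋b =
    ℕₚ.m∸n≡0⇒m≤n (∣∧<⇒≡0 p∣b∸a (ℕₚ.≤-<-trans (ℕₚ.m∸n≤m b a) b<p))
    where
    p∣b∸a : p ∣ b ∸ a
    p∣b∸a = subst (p ∣_) (trans (cong ℤ.∣_∣ (ℤₚ.m-n≡m⊖n a b)) (ℤₚ.∣⊖∣-≤ a≤b))
                  (ℤ∣.∣⇒∣ᵤ (≋⇒∣ a≋b))

  residue-unique : ∀ {a b} → a < p → b < p → + a ≋ + b → a ≡ b
  residue-unique {a} {b} a<p b<p a≋b with ℕₚ.≤-total a b
  ... | inj₁ a≤b = ℕₚ.≤-antisym a≤b (≋∧≤⇒≥ a≤b b<p a≋b)
  ... | inj₂ b≤a = ℕₚ.≤-antisym (≋∧≤⇒≥ b≤a a<p (≋-sym a≋b)) b≤a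

  0≉1 : + 0 ≋ + 1 → ⊥
  0≉1 0≋1 with residue-unique (ℕₚ.<-trans (s≤s z≤n) 1<p) 1<p 0≋1
  ... | ()

  p∸1≋-1 : + (p ∸ 1) ≋ -1ℤ
  p∸1≋-1 = begin
    + (p ∸ 1)                  ≡⟨ shift (+ (p ∸ 1)) ⟩
    + (p ∸ 1) + + 1 - + 1      ≡⟨ cong (_- + 1) (ℤₚ.pos-+ (p ∸ 1) 1) ⟨
    + (p ∸ 1 ℕ.+ 1) - + 1      ≡⟨ cong (λ x → + x - + 1) (ℕₚ.m∸n+n≡m (ℕₚ.<⇒≤ 1<p)) ⟩
    + p - + 1                  ≈⟨ +-cong m≋0 (≋-refl { - + 1}) ⟩
    -1ℤ                        ∎
    where
    shift : ∀ x → x ≡ x + + 1 - + 1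
    shift = solve-∀

  unit⇒p∤ : ∀ a {b} → + a * + b ≋ + 1 → p ∤ b
  unit⇒p∤ a ab≋1 p∣b = 0≉1 (begin
    + 0          ≡⟨ ℤₚ.*-zeroʳ (+ a) ⟨
    + a * + 0    ≈⟨ *-congˡ (+ a) (∣⇒≋0 p∣b) ⟨
    + a * + _    ≈⟨ ab≋1 ⟩
    + 1          ∎)

  square≋1 : ∀ {x} → x < p → + x * + x ≋ + 1 → x ≡ 1 ⊎ x ≡ p ∸ 1
  square≋1 {zero}  _   0≋1  = ⊥-elim (0≉1 0≋1)
  square≋1 {suc y} x<p xx≋1 with euclidsLemma y (2 ℕ.+ y) p-prime (≋0⇒∣ y[y+2]≋0)
    where
    y[y+2]≋0 : + (y ℕ.* (2 ℕ.+ y)) ≋ + 0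
    y[y+2]≋0 = begin
      + (y ℕ.* (2 ℕ.+ y))                       ≡⟨ ℤₚ.pos-* y (2 ℕ.+ y) ⟩
      + y * (+ 2 + + y)                         ≡⟨ difference-of-squares (+ y) ⟩
      (+ 1 + + y) * (+ 1 + + y) - + 1           ≈⟨ +-cong xx≋1 (≋-refl { - + 1}) ⟩
      + 0                                       ∎
      where
      difference-of-squares : ∀ y → y * (+ 2 + y) ≡ (+ 1 + y) * (+ 1 + y) - + 1
      difference-of-squares = solve-∀
  ... | inj₁ p∣y   = inj₁ (cong suc (∣∧<⇒≡0 p∣y (ℕₚ.<-trans ℕₚ.≤-refl x<p)))
  ... | inj₂ p∣y+2 = inj₂ (cong ℕ.pred (ℕₚ.≤-antisym x<p (ℕ∣.∣⇒≤ p∣y+2)))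

  oneMinusX^-coeff-over-factorial : ∀ {n k} → n < p → k ≤ n →
    (oneMinusX ^ₚ n) k * inv (n !) ≋ -1ℤ ^ k * (inv (k !) * inv ((n ∸ k) !))
  oneMinusX^-coeff-over-factorial {n} {k} n<p k≤n = begin
    (oneMinusX ^ₚ n) k * inv (n !)        ≡⟨ cong (_* inv (n !)) (oneMinusX^-coeff n k) ⟩
    -1ℤ ^ k * + (n C k) * inv (n !)       ≡⟨ ℤₚ.*-assoc (-1ℤ ^ k) (+ (n C k)) (inv (n !)) ⟩
    -1ℤ ^ k * (+ (n C k) * inv (n !))     ≈⟨ *-congˡ (-1ℤ ^ k) (binomial-over-factorial n<p k≤n) ⟩
    -1ℤ ^ k * (inv (k !) * inv ((n ∸ k) !)) ∎

module Wilson (p : ℕ) (p-prime : Prime p) (inv : ℕ → ℤ) (inv-correct : IsInverseMod p inv) where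

  open PrimeModulus p p-prime inv inv-correct
  open PairedProducts (+ p)
  open ≋-Reasoning

  inverse : ℕ → ℕ
  inverse a = inv a ℤ.%ℕ p

  inverse<p : ∀ a → inverse a < p
  inverse<p a = ℤ÷.n%ℕd<d (inv a) p

  *-inverse : ∀ {a} → p ∤ a → + a * + inverse a ≋ + 1
  *-inverse {a} p∤a = begin
    + a * + inverse a   ≈⟨ *-congˡ (+ a) inverse≋inv ⟩
    + a * inv a         ≡⟨ ℤₚ.*-comm (+ a) (inv a) ⟩
    inv a * + a         ≈⟨ inv-inverse p∤a ⟩
    + 1                 ∎
    where
    inverse≋inv : + inverse a ≋ inv a
    inverse≋inv = ≋-sym (≋-witness (inv a ℤ./ℕ p) (ℤ÷.a≡a%ℕn+[a/ℕn]*n (inv a) p))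

  inverse-involutive : ∀ {a} → a < p → p ∤ a → inverse (inverse a) ≡ a
  inverse-involutive {a} a<p p∤a = residue-unique (inverse<p b) a<p (*-cancelʳ-≋ p∤b (begin
    + inverse b * + b    ≡⟨ ℤₚ.*-comm (+ inverse b) (+ b) ⟩
    + b * + inverse b    ≈⟨ *-inverse p∤b ⟩
    + 1                  ≈⟨ *-inverse p∤a ⟨
    + a * + b            ∎))
    where
    b = inverse a
    p∤b = unit⇒p∤ a (*-inverse p∤a)

  1+x<p⇒x≢p∸1 : ∀ {x} → suc x < p → x ≢ p ∸ 1
  1+x<p⇒x≢p∸1 x+1<p x≡p∸1 = ℕₚ.<-irrefl (trans (cong suc x≡p∸1) (ℕₚ.suc-pred p)) x+1<p

  ≋-1⇒≡p∸1 : ∀ {x} → x < p → + x ≋ -1ℤ → x ≡ p ∸ 1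
  ≋-1⇒≡p∸1 x<p x≋-1 = residue-unique x<p p∸1<p (≋-trans x≋-1 (≋-sym p∸1≋-1))

  units∖-1 : List ℕ
  units∖-1 = applyDownFrom suc (p ∸ 2)

  2+[p∸2]≡p : 2 ℕ.+ (p ∸ 2) ≡ p
  2+[p∸2]≡p = ℕₚ.m+[n∸m]≡n 1<p

  ∈units∖-1⁻ : ∀ {x} → x ∈ units∖-1 → 0 < x × suc x < p
  ∈units∖-1⁻ x∈units∖-1 with ∈-applyDownFrom⁻ suc x∈units∖-1
  ... | i , i<p∸2 , refl = s≤s z≤n , subst (2 ℕ.+ i <_) 2+[p∸2]≡p (ℕₚ.+-monoʳ-< 2 i<p∸2)

  ∈units∖-1⁺ : ∀ {x} → 0 < x → suc x < p → x ∈ units∖-1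
  ∈units∖-1⁺ {suc i} _ x+1<p =
    ∈-applyDownFrom⁺ suc (ℕₚ.+-cancelˡ-< 2 i (p ∸ 2) (subst (2 ℕ.+ i <_) (sym 2+[p∸2]≡p) x+1<p))

  units∖-1-unique : Unique units∖-1
  units∖-1-unique =
    applyDownFrom⁺₁ suc (p ∸ 2) (λ j<i _ i+1≡j+1 → ℕₚ.<⇒≢ j<i (sym (ℕₚ.suc-injective i+1≡j+1)))

  inverse-paired : ∀ {x} → x ∈ units∖-1 → PairedIn units∖-1 inverse x
  inverse-paired {x} x∈units∖-1 = record
    { partner-∈  = ∈units∖-1⁺ 0<x′ x′+1<p
    ; involutive = inverse-involutive x<p p∤x
    ; inverse    = *-inverse p∤x
    ; fixed⇒≋1   = fixed⇒≋1
    }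
    where
    0<x = proj₁ (∈units∖-1⁻ x∈units∖-1)
    x+1<p = proj₂ (∈units∖-1⁻ x∈units∖-1)
    x<p = ℕₚ.<-trans ℕₚ.≤-refl x+1<p
    p∤x = 0<n<p⇒p∤n 0<x x<p
    x′ = inverse x
    0<x′ : 0 < x′
    0<x′ = ℕₚ.n≢0⇒n>0 (λ x′≡0 → unit⇒p∤ x (*-inverse p∤x) (subst (p ∣_) (sym x′≡0) (p ℕ∣.∣0)))
    x′≢p∸1 : x′ ≢ p ∸ 1
    x′≢p∸1 x′≡p∸1 = 1+x<p⇒x≢p∸1 x+1<p (≋-1⇒≡p∸1 x<p (begin
      + x                        ≡⟨ negate-twice (+ x) ⟩
      - (+ x * -1ℤ)              ≈⟨ neg-cong (*-congˡ (+ x) p∸1≋-1) ⟨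
      - (+ x * + (p ∸ 1))        ≡⟨ cong (λ y → - (+ x * + y)) x′≡p∸1 ⟨
      - (+ x * + x′)             ≈⟨ neg-cong (*-inverse p∤x) ⟩
      -1ℤ                        ∎))
      where
      negate-twice : ∀ x → x ≡ - (x * -1ℤ)
      negate-twice = solve-∀
    x′+1<p : suc x′ < p
    x′+1<p = ℕₚ.≤∧≢⇒< (inverse<p x) (λ x′+1≡p → x′≢p∸1 (cong ℕ.pred x′+1≡p))
    fixed⇒≋1 : x′ ≡ x → + x ≋ + 1
    fixed⇒≋1 x′≡x with square≋1 x<p (subst (λ y → + x * + y ≋ + 1) x′≡x (*-inverse p∤x))
    ... | inj₁ x≡1   = ≋-reflexive (cong +_ x≡1)
    ... | inj₂ x≡p∸1 = ⊥-elim (1+x<p⇒x≢p∸1 x+1<p x≡p∸1)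

  wilson : + ((p ∸ 1) !) ≋ -1ℤ
  wilson = begin
    + ((p ∸ 1) !)
      ≡⟨ cong (λ n → + (n !)) p∸1≡1+[p∸2] ⟩
    + (suc (p ∸ 2) !)
      ≡⟨ ℤₚ.pos-* (suc (p ∸ 2)) ((p ∸ 2) !) ⟩
    + suc (p ∸ 2) * + ((p ∸ 2) !)
      ≡⟨ cong₂ (λ a b → + a * + b) p∸1≡1+[p∸2] (product-applyDownFrom-suc (p ∸ 2)) ⟨
    + (p ∸ 1) * + product units∖-1
      ≈⟨ *-cong p∸1≋-1 (product-paired inverse units∖-1-unique inverse-paired) ⟩
    -1ℤ ∎
    where
    p∸1≡1+[p∸2] : p ∸ 1 ≡ suc (p ∸ 2)
    p∸1≡1+[p∸2] = cong ℕ.pred (sym 2+[p∸2]≡p)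

module FactorialReflection (p : ℕ) (p-prime : Prime p) (inv : ℕ → ℤ) (inv-correct : IsInverseMod p inv) where

  open PrimeModulus p p-prime inv inv-correct
  open Wilson p p-prime inv inv-correct using (wilson)
  open ≋-Reasoning

  -- Induction on k, using p - (k+1) ≡ -(k+1) to move one factor across.
  factorial-reflection : ∀ k → k < p → + (k ! ℕ.* (p ∸ suc k) !) ≋ -1ℤ ^ k * + ((p ∸ 1) !)
  factorial-reflection zero    _     = ≋-reflexive
    (trans (cong +_ (ℕₚ.*-identityˡ ((p ∸ 1) !))) (sym (ℤₚ.*-identityˡ (+ ((p ∸ 1) !)))))
  factorial-reflection (suc k) k+1<p = begin
    + A                                     ≡⟨ ℤₚ.neg-involutive (+ A) ⟨
    - (- + A)                               ≈⟨ neg-cong (*-cancelʳ-≋ p∤k+1 -A[k+1]≋) ⟩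
    - (-1ℤ ^ k * + ((p ∸ 1) !))             ≡⟨ ℤₚ.-1*i≡-i _ ⟨
    -1ℤ * (-1ℤ ^ k * + ((p ∸ 1) !))         ≡⟨ ℤₚ.*-assoc -1ℤ (-1ℤ ^ k) _ ⟨
    -1ℤ ^ suc k * + ((p ∸ 1) !)             ∎
    where
    b = p ∸ suc (suc k)
    A = suc k ! ℕ.* b !
    B = k ! ℕ.* suc b !
    k<p = ℕₚ.<-trans ℕₚ.≤-refl k+1<p
    p∤k+1 = 0<n<p⇒p∤n (s≤s z≤n) k+1<p
    1+b≡p∸[1+k] : suc b ≡ p ∸ suc k
    1+b≡p∸[1+k] = sym (ℕₚ.+-∸-assoc 1 k+1<p)
    1+b≋-[1+k] : + suc b ≋ - + suc k
    1+b≋-[1+k] = begin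
      + suc b                           ≡⟨ shift (+ suc b) (+ suc k) ⟩
      + suc b + + suc k - + suc k       ≡⟨ cong (_- + suc k) (ℤₚ.pos-+ (suc b) (suc k)) ⟨
      + (suc b ℕ.+ suc k) - + suc k     ≡⟨ cong (λ n → + (n ℕ.+ suc k) - + suc k) 1+b≡p∸[1+k] ⟩
      + (p ∸ suc k ℕ.+ suc k) - + suc k ≡⟨ cong (λ n → + n - + suc k) (ℕₚ.m∸n+n≡m (ℕₚ.<⇒≤ k+1<p)) ⟩
      + p - + suc k                     ≈⟨ +-cong m≋0 (≋-refl { - + suc k}) ⟩
      - + suc k                         ∎
      where
      shift : ∀ x y → x ≡ x + y - y
      shift = solve-∀
    A[1+b]≡B[1+k] : A ℕ.* suc b ≡ B ℕ.* suc k
    A[1+b]≡B[1+k] = rearrange (suc k) (suc b) (k !) (b !)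
      where
      rearrange : ∀ k b f g → k ℕ.* f ℕ.* g ℕ.* b ≡ f ℕ.* (b ℕ.* g) ℕ.* k
      rearrange = ℕ-solve-∀
    -A[k+1]≋ : - + A * + suc k ≋ -1ℤ ^ k * + ((p ∸ 1) !) * + suc k
    -A[k+1]≋ = begin
      - + A * + suc k                   ≡⟨ ℤₚ.neg-distribˡ-* (+ A) (+ suc k) ⟨
      - (+ A * + suc k)                 ≡⟨ ℤₚ.neg-distribʳ-* (+ A) (+ suc k) ⟩
      + A * - + suc k                   ≈⟨ *-congˡ (+ A) 1+b≋-[1+k] ⟨
      + A * + suc b                     ≡⟨ ℤₚ.pos-* A (suc b) ⟨
      + (A ℕ.* suc b)                   ≡⟨ cong +_ A[1+b]≡B[1+k] ⟩
      + (B ℕ.* suc k)                   ≡⟨ ℤₚ.pos-* B (suc k) ⟩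
      + B * + suc k                     ≡⟨ cong (λ n → + (k ! ℕ.* n !) * + suc k) 1+b≡p∸[1+k] ⟩
      + (k ! ℕ.* (p ∸ suc k) !) * + suc k ≈⟨ *-congʳ (+ suc k) (factorial-reflection k k<p) ⟩
      -1ℤ ^ k * + ((p ∸ 1) !) * + suc k ∎

  n![p∸n]!≋ : ∀ {n} → 0 < n → n < p → + (n ! ℕ.* (p ∸ n) !) ≋ -1ℤ ^ n * + n
  n![p∸n]!≋ {suc k} _ k+1<p = begin
    + (suc k ! ℕ.* (p ∸ suc k) !)
      ≡⟨ cong +_ (ℕₚ.*-assoc (suc k) (k !) _) ⟩
    + (suc k ℕ.* (k ! ℕ.* (p ∸ suc k) !))
      ≡⟨ ℤₚ.pos-* (suc k) _ ⟩
    + suc k * + (k ! ℕ.* (p ∸ suc k) !)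
      ≈⟨ *-congˡ (+ suc k) (factorial-reflection k (ℕₚ.<-trans ℕₚ.≤-refl k+1<p)) ⟩
    + suc k * (-1ℤ ^ k * + ((p ∸ 1) !))
      ≈⟨ *-congˡ (+ suc k) (*-congˡ (-1ℤ ^ k) wilson) ⟩
    + suc k * (-1ℤ ^ k * -1ℤ)
      ≡⟨ rearrange (+ suc k) (-1ℤ ^ k) ⟩
    -1ℤ * -1ℤ ^ k * + suc k ∎
    where
    rearrange : ∀ n s → n * (s * -1ℤ) ≡ -1ℤ * s * n
    rearrange = solve-∀

  inv-via-factorials : ∀ {n} → 0 < n → n < p → -1ℤ ^ n * inv (n !) * inv ((p ∸ n) !) ≋ inv n
  inv-via-factorials {n} 0<n n<p = inv-unique (0<n<p⇒p∤n 0<n n<p) (begin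
    -1ℤ ^ n * i * j * + n             ≡⟨ regroup (-1ℤ ^ n) i j (+ n) ⟩
    i * j * (-1ℤ ^ n * + n)           ≈⟨ *-congˡ (i * j) (n![p∸n]!≋ 0<n n<p) ⟨
    i * j * + (n ! ℕ.* (p ∸ n) !)     ≡⟨ cong (i * j *_) (ℤₚ.pos-* (n !) ((p ∸ n) !)) ⟩
    i * j * (+ (n !) * + ((p ∸ n) !)) ≡⟨ regroup′ i j (+ (n !)) (+ ((p ∸ n) !)) ⟩
    i * + (n !) * (j * + ((p ∸ n) !) * + 1)
      ≈⟨ inv-cancel (p∤n! n<p) _ ⟩
    j * + ((p ∸ n) !) * + 1
      ≈⟨ inv-cancel (p∤n! (ℕₚ.∸-monoʳ-< 0<n (ℕₚ.<⇒≤ n<p))) (+ 1) ⟩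
    + 1                               ∎)
    where
    i = inv (n !)
    j = inv ((p ∸ n) !)
    regroup : ∀ s x y n → s * x * y * n ≡ x * y * (s * n)
    regroup = solve-∀
    regroup′ : ∀ x y a b → x * y * (a * b) ≡ x * a * (y * b * + 1)
    regroup′ = solve-∀

[m∸o]∸[n∸o]≡m∸n : ∀ {o n m} → o ≤ n → n ≤ m → (m ∸ o) ∸ (n ∸ o) ≡ m ∸ n
[m∸o]∸[n∸o]≡m∸n z≤n       _         = refl
[m∸o]∸[n∸o]≡m∸n (s≤s o≤n) (s≤s n≤m) = [m∸o]∸[n∸o]≡m∸n o≤n n≤m

module HCoefficients (p : ℕ) (p-prime : Prime p) (inv : ℕ → ℤ) (inv-correct : IsInverseMod p inv) where

  open PrimeModulus p p-prime inv inv-correct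
  open FactorialReflection p p-prime inv inv-correct using (inv-via-factorials)

  weight : ℕ → ℤ
  weight r = inv (r ! ℕ.* (p ∸ r) !)

  -- term i is the summand r = i + 1 of h(x, 1 - x).
  term : ℕ → Poly
  term i = const (weight (suc i)) ⊛ X ^ₚ suc i ⊛ oneMinusX ^ₚ (p ∸ suc i)

  term-coeff : ∀ {i n} → suc i ≤ n → term i n ≡ weight (suc i) * (oneMinusX ^ₚ (p ∸ suc i)) (n ∸ suc i)
  term-coeff {i} {n} = monomial-⊛-coeff (weight (suc i)) (suc i) (oneMinusX ^ₚ (p ∸ suc i)) n

  term-coeff-< : ∀ {i n} → n < suc i → term i n ≡ + 0
  term-coeff-< {i} {n} = monomial-⊛-coeff-< (weight (suc i)) (suc i) (oneMinusX ^ₚ (p ∸ suc i)) n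

  h-coeff : ∀ n → hEval p inv X oneMinusX n ≡ - sumℤ (p ∸ 1) (λ i → term i n)
  h-coeff n = cong -_ (psum-coeff (p ∸ 1) term n)

  1+i<p : ∀ {i} → i < p ∸ 1 → suc i < p
  1+i<p i<p∸1 = ℕₚ.≤-<-trans i<p∸1 p∸1<p

  h-coeff-zero : hEval p inv X oneMinusX 0 ≡ + 0
  h-coeff-zero = trans (h-coeff 0)
    (cong -_ (sum-zero (p ∸ 1) (λ i _ → term-coeff-< (s≤s z≤n))))

  h-coeff->p : ∀ {n} → p < n → hEval p inv X oneMinusX n ≡ + 0
  h-coeff->p {n} p<n = trans (h-coeff n) (cong -_ (sum-zero (p ∸ 1) term-vanishes))
    where
    term-vanishes : ∀ i → i < p ∸ 1 → term i n ≡ + 0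
    term-vanishes i i<p∸1 = begin
      term i n
        ≡⟨ term-coeff (ℕₚ.<⇒≤ (ℕₚ.<-trans (1+i<p i<p∸1) p<n)) ⟩
      weight (suc i) * (oneMinusX ^ₚ (p ∸ suc i)) (n ∸ suc i)
        ≡⟨ cong (weight (suc i) *_)
             (oneMinusX^-coeff-> (p ∸ suc i) (n ∸ suc i) (ℕₚ.∸-monoˡ-< p<n (ℕₚ.<⇒≤ (1+i<p i<p∸1)))) ⟩
      weight (suc i) * + 0
        ≡⟨ ℤₚ.*-zeroʳ (weight (suc i)) ⟩
      + 0 ∎
      where open ≡-Reasoning

  h-coeff-p : hEval p inv X oneMinusX p ≡ - sumℤ (p ∸ 1) (λ i → weight (suc i) * -1ℤ ^ (p ∸ suc i))
  h-coeff-p = trans (h-coeff p) (cong -_ (sum-cong (p ∸ 1) λ i i<p∸1 →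
    trans (term-coeff (ℕₚ.<⇒≤ (1+i<p i<p∸1))) (cong (weight (suc i) *_) (oneMinusX^-coeff-diag (p ∸ suc i)))))

  h-coeff-p-odd : p ≢ 2 → hEval p inv X oneMinusX p ≡ + 0
  h-coeff-p-odd p≢2 = trans h-coeff-p (cong -_ (sum-antisymmetric (p ∸ 1) antisymmetric))
    where
    open ≡-Reasoning
    antisymmetric : ∀ i → i < p ∸ 1 → weight (suc (p ∸ 1 ∸ suc i)) * -1ℤ ^ (p ∸ suc (p ∸ 1 ∸ suc i))
                                      ≡ - (weight (suc i) * -1ℤ ^ (p ∸ suc i))
    antisymmetric i i<p∸1 = begin
      weight (suc (p ∸ 1 ∸ suc i)) * -1ℤ ^ (p ∸ suc (p ∸ 1 ∸ suc i))
        ≡⟨ cong₂ (λ m r → inv (m ! ℕ.* r !) * -1ℤ ^ r) mirror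
                 (trans (cong (p ∸_) mirror) (ℕₚ.m∸[m∸n]≡n r≤p)) ⟩
      inv ((p ∸ suc i) ! ℕ.* suc i !) * -1ℤ ^ suc i
        ≡⟨ cong₂ (λ m s → inv m * s) (ℕₚ.*-comm ((p ∸ suc i) !) (suc i !))
                 (-1^-complement r≤p (-1^-odd-prime p-prime p≢2)) ⟩
      weight (suc i) * - -1ℤ ^ (p ∸ suc i)
        ≡⟨ ℤₚ.neg-distribʳ-* (weight (suc i)) (-1ℤ ^ (p ∸ suc i)) ⟨
      - (weight (suc i) * -1ℤ ^ (p ∸ suc i)) ∎
      where
      r≤p = ℕₚ.<⇒≤ (1+i<p i<p∸1)
      mirror : suc (p ∸ 1 ∸ suc i) ≡ p ∸ suc i
      mirror = trans (cong suc (ℕₚ.∸-+-assoc p 1 (suc i))) (sym (ℕₚ.+-∸-assoc 1 (1+i<p i<p∸1)))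

  -- Both sides are (-1)^(n-r) / (r! (n-r)! (p-n)!) with r = i + 1.
  term-symmetry : ∀ {i n} → i < n → n < p →
    term i n ≋ -1ℤ ^ n * inv (n !) * inv ((p ∸ n) !) * (oneMinusX ^ₚ n) (suc i)
  term-symmetry {i} {n} r≤n n<p = begin
    term i n
      ≡⟨ term-coeff r≤n ⟩
    weight r * (oneMinusX ^ₚ m) j
      ≈⟨ *-congʳ ((oneMinusX ^ₚ m) j) (inv-* (p∤n! r<p) (p∤n! m<p)) ⟩
    inv (r !) * inv (m !) * (oneMinusX ^ₚ m) j
      ≡⟨ regroup (inv (r !)) (inv (m !)) ((oneMinusX ^ₚ m) j) ⟩
    inv (r !) * ((oneMinusX ^ₚ m) j * inv (m !))
      ≈⟨ *-congˡ (inv (r !)) (oneMinusX^-coeff-over-factorial m<p j≤m) ⟩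
    inv (r !) * (-1ℤ ^ j * (inv (j !) * inv ((m ∸ j) !)))
      ≡⟨ cong₂ (λ s a → inv (r !) * (s * (inv (j !) * inv (a !))))
               (-1^-* r≤n) (sym ([m∸o]∸[n∸o]≡m∸n r≤n (ℕₚ.<⇒≤ n<p))) ⟨
    inv (r !) * (-1ℤ ^ n * -1ℤ ^ r * (inv (j !) * inv ((p ∸ n) !)))
      ≡⟨ regroup′ (inv (r !)) (-1ℤ ^ n) (-1ℤ ^ r) (inv (j !)) (inv ((p ∸ n) !)) ⟩
    -1ℤ ^ n * inv ((p ∸ n) !) * (-1ℤ ^ r * (inv (r !) * inv (j !)))
      ≈⟨ *-congˡ (-1ℤ ^ n * inv ((p ∸ n) !)) (oneMinusX^-coeff-over-factorial n<p r≤n) ⟨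
    -1ℤ ^ n * inv ((p ∸ n) !) * ((oneMinusX ^ₚ n) r * inv (n !))
      ≡⟨ regroup″ (-1ℤ ^ n) (inv ((p ∸ n) !)) ((oneMinusX ^ₚ n) r) (inv (n !)) ⟩
    -1ℤ ^ n * inv (n !) * inv ((p ∸ n) !) * (oneMinusX ^ₚ n) r ∎
    where
    open ≋-Reasoning
    r = suc i
    j = n ∸ r
    m = p ∸ r
    r<p = ℕₚ.<-≤-trans (s≤s r≤n) n<p
    m<p = ℕₚ.∸-monoʳ-< {o = 0} (s≤s z≤n) (ℕₚ.<⇒≤ r<p)
    j≤m = ℕₚ.∸-monoˡ-≤ r (ℕₚ.<⇒≤ n<p)
    regroup : ∀ a b c → a * b * c ≡ a * (c * b)
    regroup = solve-∀
    regroup′ : ∀ x s t y z → x * (s * t * (y * z)) ≡ s * z * (t * (x * y))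
    regroup′ = solve-∀
    regroup″ : ∀ s z c x → s * z * (c * x) ≡ s * x * z * c
    regroup″ = solve-∀

  h-coeff-between : ∀ {n} → 0 < n → n < p → hEval p inv X oneMinusX n ≋ inv n
  h-coeff-between {suc k} 0<n n<p = begin
    hEval p inv X oneMinusX n
      ≡⟨ h-coeff n ⟩
    - sumℤ (p ∸ 1) (λ i → term i n)
      ≡⟨ cong -_ (sum-truncate n (p ∸ 1) (ℕₚ.<⇒≤pred n<p) (λ i n≤i _ → term-coeff-< (s≤s n≤i))) ⟩
    - sumℤ n (λ i → term i n)
      ≈⟨ neg-cong (sum-cong-≋ n (λ i i<n → term-symmetry i<n n<p)) ⟩
    - sumℤ n (λ i → K * (oneMinusX ^ₚ n) (suc i))
      ≡⟨ cong -_ (sum-*ˡ n K (λ i → (oneMinusX ^ₚ n) (suc i))) ⟩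
    - (K * sumℤ n (λ i → (oneMinusX ^ₚ n) (suc i)))
      ≡⟨ cong (λ s → - (K * s)) (sum-coeff-oneMinusX^ k) ⟩
    - (K * -1ℤ)
      ≡⟨ negate-twice K ⟩
    K
      ≈⟨ inv-via-factorials 0<n n<p ⟩
    inv n ∎
    where
    open ≋-Reasoning
    n = suc k
    K = -1ℤ ^ n * inv (n !) * inv ((p ∸ n) !)
    negate-twice : ∀ x → - (x * -1ℤ) ≡ x
    negate-twice = solve-∀

  logSum-coeff : ∀ n → logSum p inv n ≡ sumℤ (p ∸ 1) (λ i → (const (inv (suc i)) ⊛ X ^ₚ suc i) n)
  logSum-coeff = psum-coeff (p ∸ 1) (λ i → const (inv (suc i)) ⊛ X ^ₚ suc i)

  logSum-coeff-off : ∀ {n} → (∀ i → i < p ∸ 1 → n ≢ suc i) → logSum p inv n ≡ + 0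
  logSum-coeff-off {n} n≢r = trans (logSum-coeff n)
    (sum-zero (p ∸ 1) (λ i i<p∸1 → monomial-coeff-off (inv (suc i)) (suc i) n (n≢r i i<p∸1)))

  logSum-coeff-zero : logSum p inv 0 ≡ + 0
  logSum-coeff-zero = logSum-coeff-off (λ _ _ ())

  logSum-coeff-≥p : ∀ {n} → p ≤ n → logSum p inv n ≡ + 0
  logSum-coeff-≥p p≤n = logSum-coeff-off (λ i i<p∸1 n≡1+i →
    ℕₚ.<⇒≱ (1+i<p i<p∸1) (subst (p ≤_) n≡1+i p≤n))

  logSum-coeff-between : ∀ {n} → 0 < n → n < p → logSum p inv n ≡ inv n
  logSum-coeff-between {suc k} _ n<p = trans (logSum-coeff (suc k)) (trans
    (sum-single (p ∸ 1) k (ℕₚ.<⇒≤pred n<p) (λ i _ i≢k →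
      monomial-coeff-off (inv (suc i)) (suc i) (suc k) (λ k+1≡i+1 → i≢k (sym (ℕₚ.suc-injective k+1≡i+1)))))
    (monomial-coeff-diag (inv (suc k)) (suc k)))

proposition9p4 : (p : ℕ) → Prime p → (inv : ℕ → ℤ) → IsInverseMod p inv →
    (p ≢ 2 → hEval p inv X oneMinusX ≈[ p ] logSum p inv)
    × (p ≡ 2 → hEval p inv X oneMinusX ≈[ p ] (X ⊕ (X ^ₚ 2)))
proposition9p4 p p-prime inv inv-correct =
  (λ p≢2 n → ≋⇒ModEq (odd-case p≢2 n)) , (λ p≡2 n → ≋⇒ModEq (even-case p≡2 n))
  where
  open PrimeModulus p p-prime inv inv-correct
  open HCoefficients p p-prime inv inv-correct

  odd-case : p ≢ 2 → ∀ n → hEval p inv X oneMinusX n ≋ logSum p inv n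
  odd-case _   zero    = ≋-reflexive (trans h-coeff-zero (sym logSum-coeff-zero))
  odd-case p≢2 (suc k) with ℕₚ.<-cmp (suc k) p
  ... | tri< n<p _ _  =
    ≋-trans (h-coeff-between (s≤s z≤n) n<p) (≋-reflexive (sym (logSum-coeff-between (s≤s z≤n) n<p)))
  ... | tri≈ _ refl _ = ≋-reflexive (trans (h-coeff-p-odd p≢2) (sym (logSum-coeff-≥p ℕₚ.≤-refl)))
  ... | tri> _ _ p<n  = ≋-reflexive (trans (h-coeff->p p<n) (sym (logSum-coeff-≥p (ℕₚ.<⇒≤ p<n))))

  even-case : p ≡ 2 → ∀ n → hEval p inv X oneMinusX n ≋ (X ⊕ X ^ₚ 2) n
  even-case refl 0 = ≋-reflexive h-coeff-zero
  even-case refl 1 = ≋-trans (h-coeff-between (s≤s z≤n) 1<p) inv1≋1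
  even-case refl 2 = ≋-trans (≋-reflexive (trans h-coeff-p (single-term (inv 1)))) inv1≋1
    where
    single-term : ∀ x → - (+ 0 + x * (-1ℤ * + 1)) ≡ x
    single-term = solve-∀
  even-case refl (suc (suc (suc k))) = ≋-reflexive (trans (h-coeff->p {3 ℕ.+ k} (s≤s (s≤s (s≤s z≤n))))
    (sym (trans (ℤₚ.+-identityˡ _) (X^-coeff-off 2 (3 ℕ.+ k) (λ ())))))
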